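{- Let $G=(V,E)$ be a finite simple graph and write $T\chi^o_G(q)=\sum_\alpha c^o_\alpha(q)M_\alpha$. Then each $c^o_\alpha(q)$ is a symmetric polynomial in $q$ of degree $|E|$, i.e. a polynomial of degree $|E|$ with $[q^k]c^o_\alpha(q)=[q^{|E|-k}]c^o_\alpha(q)$ for all $k$.
   Context: An orientation $\gamma$ of $G$ directs each edge; it is acyclic if there is no directed cycle. For a proper coloring $\kappa:V\to\mathbb{Z}_{>0}$ (adjacent vertices colored differently), $\mathrm{asc}^\gamma(\kappa)$ is the number of edges oriented $u\to v$ with $\kappa(u)<\kappa(v)$; $\chi^\gamma_G(x;q)=\sum_\kappa q^{\mathrm{asc}^\gamma(\kappa)}x^\kappa$ with $x^\kappa=\prod_j x_j^{\#\kappa^{ -1}(j)}$; $T\chi^o_G(q)=\sum_\gamma\chi^\gamma_G(x;q)$ over acyclic orientations $\gamma$. $M_\alpha=\sum_{i_1<\dots<i_\ell}x_{i_1}^{\alpha_1}\cdots x_{i_\ell}^{\alpha_\ell}$. -}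

module Defs where

open import Data.Nat using (ℕ; zero; suc; _+_; _∸_; _≤_)
open import Data.Bool using (Bool; true; false; if_then_else_)
open import Data.Fin using (Fin; zero; suc; inject₁; fromℕ; toℕ) renaming (_<_ to _<ᶠ_)
open import Data.Fin.Properties using () renaming (_≟_ to _≟ᶠ_; _<?_ to _<?ᶠ_)
open import Data.Vec using (Vec; lookup; toList)
open import Data.List using (List; length; filter; sum; map; allFin) renaming (lookup to lookupL)
open import Data.List.Relation.Unary.All using (All)
open import Data.List.Relation.Unary.Unique.Propositional using (Unique)
open import Data.Product using (Σ; _×_; _,_; proj₁; proj₂)
open import Function using (_∘_)
open import Function.Definitions using (Injective)
open import Relation.Binary.PropositionalEquality using (_≡_; _≢_)
open import Relation.Nullary using (¬_; yes; no)

-- A finite simple graph on the vertex set Fin n is given by its list of edges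
-- E, each edge written as (u , v) with u < v; the list has no repetitions.
-- (So: no loops, no multiple edges, undirected.)
SimpleEdges : {n : ℕ} → List (Fin n × Fin n) → Set
SimpleEdges E = All (λ e → proj₁ e <ᶠ proj₂ e) E × Unique E

nE : {n : ℕ} → List (Fin n × Fin n) → ℕ
nE = length

edge : {n : ℕ} (E : List (Fin n × Fin n)) → Fin (nE E) → Fin n × Fin n
edge E i = lookupL E i

-- An orientation assigns to each edge i a Bool: true means proj₁ → proj₂,
-- false means proj₂ → proj₁.
Orientation : {n : ℕ} → List (Fin n × Fin n) → Set
Orientation E = Vec Bool (nE E)

tailV : {n : ℕ} (E : List (Fin n × Fin n)) → Orientation E → Fin (nE E) → Fin n
tailV E γ i = if lookup γ i then proj₁ (edge E i) else proj₂ (edge E i)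

headV : {n : ℕ} (E : List (Fin n × Fin n)) → Orientation E → Fin (nE E) → Fin n
headV E γ i = if lookup γ i then proj₂ (edge E i) else proj₁ (edge E i)

Arc : {n : ℕ} (E : List (Fin n × Fin n)) → Orientation E → Fin n → Fin n → Set
Arc E γ u v = Σ (Fin (nE E)) λ i → (tailV E γ i ≡ u) × (headV E γ i ≡ v)

DirectedCycle : {n : ℕ} (E : List (Fin n × Fin n)) → Orientation E → Set
DirectedCycle {n} E γ =
  Σ ℕ λ k → Σ (Fin (suc (suc k)) → Fin n) λ vs →
    Injective _≡_ _≡_ vs
    × ((i : Fin (suc k)) → Arc E γ (vs (inject₁ i)) (vs (suc i)))
    × Arc E γ (vs (fromℕ (suc k))) (vs zero)

Acyclic : {n : ℕ} (E : List (Fin n × Fin n)) → Orientation E → Set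
Acyclic E γ = ¬ DirectedCycle E γ

-- Colorings with colours in {1,…,ℓ}, represented by Fin ℓ (colour j ↦ toℕ j + 1).
Coloring : ℕ → ℕ → Set
Coloring n ℓ = Vec (Fin ℓ) n

Proper : {n ℓ : ℕ} (E : List (Fin n × Fin n)) → Coloring n ℓ → Set
Proper E κ = (i : Fin (nE E)) → lookup κ (proj₁ (edge E i)) ≢ lookup κ (proj₂ (edge E i))

colorCount : {n ℓ : ℕ} → Coloring n ℓ → Fin ℓ → ℕ
colorCount κ j = length (filter (_≟ᶠ j) (toList κ))

HasContent : {n ℓ : ℕ} → Coloring n ℓ → Vec ℕ ℓ → Set
HasContent κ α = (j : Fin _) → colorCount κ j ≡ lookup α j

asc : {n ℓ : ℕ} (E : List (Fin n × Fin n)) → Orientation E → Coloring n ℓ → ℕ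
asc E γ κ =
  length (filter (λ i → lookup κ (tailV E γ i) <?ᶠ lookup κ (headV E γ i)) (allFin (nE E)))

-- The (proof-irrelevant) set of pairs (γ , κ) with γ acyclic, κ proper of
-- content α and asc^γ(κ) = k.  Its cardinality is [q^k] c^o_α(q).
record Term {n ℓ : ℕ} (E : List (Fin n × Fin n)) (α : Vec ℕ ℓ) (k : ℕ) : Set where
  constructor term
  field
    γ : Orientation E
    κ : Coloring n ℓ
    .acyclic : Acyclic E γ
    .proper : Proper E κ
    .content : HasContent κ α
    .ascEq : asc E γ κ ≡ k

Composition : {ℓ : ℕ} → Vec ℕ ℓ → Set
Composition α = (j : Fin _) → 1 ≤ lookup α j

-- Reversing every edge of an acyclic orientation gives an acyclic orientation,
-- and since a proper colouring gives the two ends of each edge different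
-- colours, every edge is an ascent in exactly one of γ and its converse:
-- asc(converse γ) = |E| − asc(γ).  So reversal is a bijection between the
-- terms counted by [q^k] and by [q^{|E|−k}].  No term has more than |E|
-- ascents, and any proper colouring κ of content α has |E| ascents for the
-- acyclic orientation that points every edge towards the larger colour.
module Submission where

open import Defs
open import Data.Nat as ℕ using (ℕ; zero; suc; _+_; _∸_; _≤_; _<_)
import Data.Nat.Properties as ℕ
open import Data.Bool using (true; false; not; if_then_else_)
open import Data.Bool.Properties using (not-involutive)
open import Data.Fin using (Fin; zero; suc; toℕ; inject₁; fromℕ; opposite) renaming (_<_ to _<ᶠ_)
open import Data.Fin.Properties using (¬Fin0; <-asym; ≤∧≢⇒<; opposite-involutive) renaming (_<?_ to _<?ᶠ_)
open import Data.Fin.Permutation using (↔⇒≡)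
open import Data.Vec using (Vec; lookup; tabulate; map)
open import Data.Vec.Properties using (lookup-map; lookup∘tabulate; map-∘; map-cong; map-id)
open import Data.List using (List; []; _∷_; length; filter; allFin)
open import Data.List.Properties using (length-filter; length-tabulate; filter-all)
open import Data.List.Relation.Unary.All.Properties using (tabulate⁺)
open import Data.Product using (Σ; _×_; _,_; proj₁; proj₂)
open import Data.Empty using (⊥-elim)
import Data.Empty.Irrelevant as Irrelevant
open import Function using (_∘_)
open import Function.Bundles using (_↔_; Inverse; mk↔ₛ′)
open import Function.Properties.Inverse using (↔-sym; ↔-trans)
open import Level using (Level)
open import Relation.Binary.PropositionalEquality using (_≡_; _≢_; refl; sym; trans; cong; subst; subst₂; ≢-sym; module ≡-Reasoning)
open import Relation.Nullary using (¬_; Dec; yes; no; does)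
open import Relation.Unary using (Pred; Decidable)

private
  variable
    a p q : Level
    A : Set a

↔⇒card≡ : ∀ {m n} → A ↔ Fin m → A ↔ Fin n → m ≡ n
↔⇒card≡ A↔m A↔n = ↔⇒≡ (↔-trans (↔-sym A↔m) A↔n)

¬inhabited⇒card≡0 : ∀ {m} → A ↔ Fin m → ¬ A → m ≡ 0
¬inhabited⇒card≡0 {m = zero}  _   _  = refl
¬inhabited⇒card≡0 {m = suc _} A↔m ¬a = ⊥-elim (¬a (Inverse.from A↔m zero))

card≢0⇒inhabited : ∀ {m} → A ↔ Fin m → m ≢ 0 → A
card≢0⇒inhabited {m = zero}  _   m≢0 = ⊥-elim (m≢0 refl)
card≢0⇒inhabited {m = suc _} A↔m _   = Inverse.from A↔m zero

inhabited⇒card≢0 : ∀ {m} → A ↔ Fin m → A → m ≢ 0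
inhabited⇒card≢0 A↔m x m≡0 = ¬Fin0 (subst Fin m≡0 (Inverse.to A↔m x))

length-filter-complementary : {P : Pred A p} {Q : Pred A q} (P? : Decidable P) (Q? : Decidable Q) →
  (∀ x → P x → ¬ Q x) → (∀ x → ¬ P x → Q x) →
  ∀ xs → length (filter P? xs) + length (filter Q? xs) ≡ length xs
length-filter-complementary P? Q? disjoint exhaustive [] = refl
length-filter-complementary P? Q? disjoint exhaustive (x ∷ xs) with P? x | Q? x
... | yes px | yes qx = ⊥-elim (disjoint x px qx)
... | yes _  | no _   = cong suc (length-filter-complementary P? Q? disjoint exhaustive xs)
... | no _   | yes _  = trans (ℕ.+-suc _ _) (cong suc (length-filter-complementary P? Q? disjoint exhaustive xs))
... | no ¬px | no ¬qx = ⊥-elim (¬qx (exhaustive x ¬px))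

increasing⇒first≤last : ∀ m (g : Fin (suc m) → ℕ) → (∀ i → g (inject₁ i) < g (suc i)) → g zero ≤ g (fromℕ m)
increasing⇒first≤last zero    g increasing = ℕ.≤-refl
increasing⇒first≤last (suc m) g increasing =
  ℕ.≤-trans (ℕ.<⇒≤ (increasing zero)) (increasing⇒first≤last m (g ∘ suc) (increasing ∘ suc))

opposite-inject₁ : ∀ {m} (i : Fin (suc m)) → opposite (inject₁ i) ≡ suc (opposite i)
opposite-inject₁         zero    = refl
opposite-inject₁ {suc m} (suc i) = cong inject₁ (opposite-inject₁ i)

opposite-fromℕ : ∀ m → opposite (fromℕ m) ≡ zero
opposite-fromℕ zero    = refl
opposite-fromℕ (suc m) = cong inject₁ (opposite-fromℕ m)

module _ {n : ℕ} (E : List (Fin n × Fin n)) where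

  converse : Orientation E → Orientation E
  converse = map not

  converse-involutive : ∀ γ → converse (converse γ) ≡ γ
  converse-involutive γ = begin
    map not (map not γ) ≡⟨ map-∘ not not γ ⟨
    map (not ∘ not) γ   ≡⟨ map-cong not-involutive γ ⟩
    map (λ b → b) γ     ≡⟨ map-id γ ⟩
    γ                   ∎
    where open ≡-Reasoning

  tailV-converse : ∀ γ i → tailV E (converse γ) i ≡ headV E γ i
  tailV-converse γ i rewrite lookup-map i not γ with lookup γ i
  ... | true  = refl
  ... | false = refl

  headV-converse : ∀ γ i → headV E (converse γ) i ≡ tailV E γ i
  headV-converse γ i rewrite lookup-map i not γ with lookup γ i
  ... | true  = refl
  ... | false = refl

  Arc-converse : ∀ γ {u v} → Arc E (converse γ) u v → Arc E γ v u
  Arc-converse γ (i , tail≡u , head≡v) =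
    i , trans (sym (headV-converse γ i)) head≡v , trans (sym (tailV-converse γ i)) tail≡u

  converse-acyclic : ∀ γ → Acyclic E γ → Acyclic E (converse γ)
  converse-acyclic γ acyclic (k , vs , vs-injective , arcs , closing) =
    acyclic (k , vs ∘ opposite , reversed-injective , reversed-arcs , reversed-closing)
    where
    reversed-injective : ∀ {i j} → vs (opposite i) ≡ vs (opposite j) → i ≡ j
    reversed-injective {i} {j} eq =
      trans (sym (opposite-involutive i)) (trans (cong opposite (vs-injective eq)) (opposite-involutive j))

    reversed-arcs : ∀ i → Arc E γ (vs (opposite (inject₁ i))) (vs (opposite (suc i)))
    reversed-arcs i = subst (λ j → Arc E γ (vs j) (vs (inject₁ (opposite i))))
      (sym (opposite-inject₁ i)) (Arc-converse γ (arcs (opposite i)))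

    reversed-closing : Arc E γ (vs (opposite (fromℕ (suc k)))) (vs (opposite zero))
    reversed-closing = subst (λ j → Arc E γ (vs j) (vs (fromℕ (suc k))))
      (sym (opposite-fromℕ (suc k))) (Arc-converse γ closing)

  acyclic-if-increasing : ∀ γ (f : Fin n → ℕ) → (∀ {u v} → Arc E γ u v → f u < f v) → Acyclic E γ
  acyclic-if-increasing γ f increasing (k , vs , _ , arcs , closing) =
    ℕ.<-irrefl refl (ℕ.≤-<-trans
      (increasing⇒first≤last (suc k) (f ∘ vs) (increasing ∘ arcs)) (increasing closing))

  module _ {ℓ : ℕ} (κ : Coloring n ℓ) where

    tail≢head : Proper E κ → ∀ γ i → lookup κ (tailV E γ i) ≢ lookup κ (headV E γ i)
    tail≢head proper γ i with lookup γ i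
    ... | true  = proper i
    ... | false = ≢-sym (proper i)

    asc≤nE : ∀ γ → asc E γ κ ≤ nE E
    asc≤nE γ = ℕ.≤-trans (length-filter _ (allFin (nE E))) (ℕ.≤-reflexive (length-tabulate _))

    asc-converse : Proper E κ → ∀ γ → asc E (converse γ) κ + asc E γ κ ≡ nE E
    asc-converse proper γ =
      trans (length-filter-complementary (ascent? (converse γ)) (ascent? γ) disjoint exhaustive (allFin (nE E)))
            (length-tabulate _)
      where
      Ascent : Orientation E → Fin (nE E) → Set
      Ascent δ i = lookup κ (tailV E δ i) <ᶠ lookup κ (headV E δ i)

      ascent? : ∀ δ → Decidable (Ascent δ)
      ascent? δ i = lookup κ (tailV E δ i) <?ᶠ lookup κ (headV E δ i)

      descent : ∀ i → Ascent (converse γ) i → lookup κ (headV E γ i) <ᶠ lookup κ (tailV E γ i)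
      descent i = subst₂ _<ᶠ_ (cong (lookup κ) (tailV-converse γ i)) (cong (lookup κ) (headV-converse γ i))

      disjoint : ∀ i → Ascent (converse γ) i → ¬ Ascent γ i
      disjoint i = <-asym ∘ descent i

      exhaustive : ∀ i → ¬ Ascent (converse γ) i → Ascent γ i
      exhaustive i ¬ascent = ≤∧≢⇒< (ℕ.≮⇒≥ (¬ascent ∘ ascent)) (tail≢head proper γ i)
        where
        ascent : lookup κ (headV E γ i) <ᶠ lookup κ (tailV E γ i) → Ascent (converse γ) i
        ascent = subst₂ _<ᶠ_ (cong (lookup κ) (sym (tailV-converse γ i))) (cong (lookup κ) (sym (headV-converse γ i)))

    ascending : Orientation E
    ascending = tabulate λ i → does (lookup κ (proj₁ (edge E i)) <?ᶠ lookup κ (proj₂ (edge E i)))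

    ascending-ascent : Proper E κ → ∀ i → lookup κ (tailV E ascending i) <ᶠ lookup κ (headV E ascending i)
    ascending-ascent proper i
      rewrite lookup∘tabulate (λ i → does (lookup κ (proj₁ (edge E i)) <?ᶠ lookup κ (proj₂ (edge E i)))) i
      = towards-larger (proper i) (lookup κ (proj₁ (edge E i)) <?ᶠ lookup κ (proj₂ (edge E i)))
      where
      towards-larger : ∀ {u v} → lookup κ u ≢ lookup κ v → (u<?v : Dec (lookup κ u <ᶠ lookup κ v)) →
        lookup κ (if does u<?v then u else v) <ᶠ lookup κ (if does u<?v then v else u)
      towards-larger _   (yes u<v) = u<v
      towards-larger u≢v (no u≮v)  = ≤∧≢⇒< (ℕ.≮⇒≥ u≮v) (≢-sym u≢v)

    asc-ascending : Proper E κ → asc E ascending κ ≡ nE E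
    asc-ascending proper =
      trans (cong length (filter-all _ (tabulate⁺ (ascending-ascent proper)))) (length-tabulate _)

    ascending-acyclic : Proper E κ → Acyclic E ascending
    ascending-acyclic proper = acyclic-if-increasing ascending (toℕ ∘ lookup κ) λ where
      (i , refl , refl) → ascending-ascent proper i

module _ {n ℓ : ℕ} {E : List (Fin n × Fin n)} {α : Vec ℕ ℓ} where

  converseTerm : ∀ {j k} → j + k ≡ nE E → Term E α k → Term E α j
  converseTerm {j} {k} j+k≡nE (term γ κ acyclic proper content asc≡k) =
    term (converse E γ) κ (converse-acyclic E γ acyclic) proper content (ℕ.+-cancelʳ-≡ k _ _ (begin
      asc E (converse E γ) κ + k          ≡⟨ cong (asc E (converse E γ) κ +_) asc≡k ⟨
      asc E (converse E γ) κ + asc E γ κ  ≡⟨ asc-converse E κ proper γ ⟩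
      nE E                                ≡⟨ j+k≡nE ⟨
      j + k                               ∎))
    where open ≡-Reasoning

  converseTerm-involutive : ∀ {j k} (j+k≡nE : j + k ≡ nE E) (k+j≡nE : k + j ≡ nE E) t →
    converseTerm {k} {j} k+j≡nE (converseTerm {j} {k} j+k≡nE t) ≡ t
  converseTerm-involutive _ _ (term γ _ _ _ _ _) = term-≡ (converse-involutive E γ)
    where
    term-≡ : ∀ {k γ γ′ κ} .{a a′ p p′ c c′ e e′} → γ ≡ γ′ →
      term {E = E} {α = α} {k = k} γ κ a p c e ≡ term γ′ κ a′ p′ c′ e′
    term-≡ refl = refl

  converseTerm-↔ : ∀ {j k} → j + k ≡ nE E → Term E α k ↔ Term E α j
  converseTerm-↔ {j} {k} j+k≡nE = mk↔ₛ′ (converseTerm j+k≡nE) (converseTerm k+j≡nE)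
    (converseTerm-involutive k+j≡nE j+k≡nE) (converseTerm-involutive j+k≡nE k+j≡nE)
    where
    k+j≡nE : k + j ≡ nE E
    k+j≡nE = trans (ℕ.+-comm k j) j+k≡nE

  Term-empty-above-nE : ∀ {k} → nE E < k → ¬ Term E α k
  Term-empty-above-nE nE<k (term γ κ _ _ _ asc≡k) =
    Irrelevant.⊥-elim (ℕ.<-irrefl refl (ℕ.<-≤-trans nE<k (subst (_≤ nE E) asc≡k (asc≤nE E κ γ))))

  Term-nE : ∀ {k} → Term E α k → Term E α (nE E)
  Term-nE (term _ κ _ proper content _) =
    term (ascending E κ) κ (ascending-acyclic E κ proper) proper content (asc-ascending E κ proper)

theorem3p10 : (n : ℕ) (E : List (Fin n × Fin n)) → SimpleEdges E →
    (ℓ : ℕ) (α : Vec ℕ ℓ) → Composition α →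
    (c : ℕ → ℕ) → ((k : ℕ) → Term E α k ↔ Fin (c k)) →
      ((k : ℕ) → k ≤ nE E → c k ≡ c (nE E ∸ k))
      × ((k : ℕ) → nE E < k → c k ≡ 0)
      × ((Σ ℕ λ k → c k ≢ 0) → c (nE E) ≢ 0)
theorem3p10 n E _ ℓ α _ c Term↔c = symmetric , vanishes-above-nE , top-nonzero
  where
  symmetric : (k : ℕ) → k ≤ nE E → c k ≡ c (nE E ∸ k)
  symmetric k k≤nE = ↔⇒card≡ (Term↔c k) (↔-trans (converseTerm-↔ (ℕ.m∸n+n≡m k≤nE)) (Term↔c (nE E ∸ k)))

  vanishes-above-nE : (k : ℕ) → nE E < k → c k ≡ 0
  vanishes-above-nE k nE<k = ¬inhabited⇒card≡0 (Term↔c k) (Term-empty-above-nE nE<k)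

  top-nonzero : (Σ ℕ λ k → c k ≢ 0) → c (nE E) ≢ 0
  top-nonzero (k , ck≢0) = inhabited⇒card≢0 (Term↔c (nE E)) (Term-nE (card≢0⇒inhabited (Term↔c k) ck≢0))
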